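{- The only hook partitions $(a,1^b)$ ($a\ge1$, $b\ge0$) such that $c^\lambda_{sp}(u)\notin\{1,-1\}$ for all cells $u\in\lambda$ are $(1)$ and $(2,1)$.
   Context: The notation $(a,1^b)$ denotes the partition with one part $a$ followed by $b$ parts equal to $1$. For a partition $\lambda$ with conjugate $\lambda'$ (cells $(i,j)$ = row $i$, column $j$ of the Young diagram; $\lambda_i=0$ beyond the length), the symplectic content of a cell $(i,j)\in\lambda$ is $c^\lambda_{sp}(i,j)=\lambda_i+\lambda_j-i-j+2$ if $i>j$, and $c^\lambda_{sp}(i,j)=i+j-\lambda'_i-\lambda'_j$ if $i\le j$. -}

module Defs where

open import Data.Nat using (ℕ; zero; suc; _≤_; _<ᵇ_; _≤ᵇ_)
open import Data.Bool using (if_then_else_)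
open import Data.List using (List; []; _∷_; replicate; length; filter)
open import Data.Integer using (ℤ; +_; _-_; _+_)
open import Data.Product using (_×_)
open import Relation.Nullary using (¬_)
open import Relation.Binary.PropositionalEquality using (_≡_)

-- A partition is a list of parts (weakly decreasing, positive).

-- Row length λ_i (rows indexed from 1; 0 beyond the length).
part : List ℕ → ℕ → ℕ
part []       _             = 0
part (x ∷ xs) zero          = 0
part (x ∷ xs) (suc zero)    = x
part (x ∷ xs) (suc (suc i)) = part xs (suc i)

conj : List ℕ → ℕ → ℕ
conj []       _ = 0
conj (x ∷ xs) j = if j ≤ᵇ x then suc (conj xs j) else conj xs j

InDiagram : List ℕ → ℕ → ℕ → Set
InDiagram μ i j = (1 ≤ i) × (1 ≤ j) × (j ≤ part μ i)

cSp : List ℕ → ℕ → ℕ → ℤ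
cSp μ i j =
  if j <ᵇ i
  then ((((+ part μ i) + (+ part μ j)) - (+ i)) - (+ j)) + (+ 2)
  else (((+ i) + (+ j)) - (+ conj μ i)) - (+ conj μ j)

hook : ℕ → ℕ → List ℕ
hook a b = a ∷ replicate b 1

-- In the hook (a, 1^b) the arm cell (1, j) has symplectic content j − b − 1 and the leg
-- cell (i, 1) has content a − i + 2. The leg contains the content 1 unless b < a, the arm
-- contains 1 unless a ≤ b + 1, so a = b + 1; the arm then contains −1 at j = b unless b ≤ 1.
module Submission where

open import Defs
open import Data.Nat using (ℕ; _≤_; _<_; zero; suc; z≤n; s≤s)
open import Data.Nat.Properties using (≤⇒≤ᵇ; ≰⇒>; ≮⇒≥; ≤-antisym; ≤-reflexive; <⇒≤)
open import Data.Integer using (+_; -_; _-_; _+_)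
open import Data.Integer.Tactic.RingSolver using (solve-∀)
open import Data.Bool.Properties using (T-≡)
open import Data.List using (List; replicate)
open import Data.Product using (_×_; _,_; proj₁; proj₂)
open import Data.Sum using (_⊎_; inj₁; inj₂)
open import Data.Empty using (⊥-elim)
open import Function.Bundles using (_⇔_; mk⇔; Equivalence)
open import Relation.Nullary using (¬_)
open import Relation.Binary.PropositionalEquality using (_≡_; refl; sym; cong; trans)

AvoidsSpContent±1 : List ℕ → Set
AvoidsSpContent±1 μ = ∀ i j → InDiagram μ i j →
  ¬ (cSp μ i j ≡ + 1) × ¬ (cSp μ i j ≡ - (+ 1))

conj-replicate-1-1 : ∀ b → conj (replicate b 1) 1 ≡ b
conj-replicate-1-1 zero    = refl
conj-replicate-1-1 (suc b) = cong suc (conj-replicate-1-1 b)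

conj-replicate-1-≥2 : ∀ b {j} → 2 ≤ j → conj (replicate b 1) j ≡ 0
conj-replicate-1-≥2 zero    _                     = refl
conj-replicate-1-≥2 (suc b) j≥2@(s≤s (s≤s _)) = conj-replicate-1-≥2 b j≥2

part-replicate-1 : ∀ {b i} → 1 ≤ i → i ≤ b → part (replicate b 1) i ≡ 1
part-replicate-1 {suc b} {suc zero}    _ _             = refl
part-replicate-1 {suc b} {suc (suc i)} _ (s≤s i+1≤b) = part-replicate-1 (s≤s z≤n) i+1≤b

hook-arm-cell : ∀ {a} b {j} → 1 ≤ j → j ≤ a → InDiagram (hook a b) 1 j
hook-arm-cell b j≥1 j≤a = s≤s z≤n , j≥1 , j≤a

hook-leg-cell : ∀ a {b i} → 2 ≤ i → i ≤ suc b → InDiagram (hook a b) i 1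
hook-leg-cell a {b} (s≤s (s≤s _)) (s≤s i≤b) =
  s≤s z≤n , s≤s z≤n , ≤-reflexive (sym (part-replicate-1 {b} (s≤s z≤n) i≤b))

cSp-hook-arm : ∀ {a} b {j} → 2 ≤ j → j ≤ a → cSp (hook a b) 1 j ≡ + j - + b - + 1
cSp-hook-arm {suc a} b {j} j≥2@(s≤s (s≤s _)) j≤a
  rewrite Equivalence.to T-≡ (≤⇒≤ᵇ j≤a)
        | conj-replicate-1-1 b
        | conj-replicate-1-≥2 b j≥2 = simplify (+ j) (+ b)
  where
  simplify : ∀ x y → (+ 1 + x - (+ 1 + y)) - + 1 ≡ x - y - + 1
  simplify = solve-∀

cSp-hook-leg : ∀ a {b i} → 2 ≤ i → i ≤ suc b → cSp (hook a b) i 1 ≡ + a - + i + + 2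
cSp-hook-leg a {b} {i} (s≤s (s≤s _)) (s≤s i≤b)
  rewrite part-replicate-1 {b} (s≤s z≤n) i≤b = simplify (+ a) (+ i)
  where
  simplify : ∀ x y → + 1 + x - y - + 1 + + 2 ≡ x - y + + 2
  simplify = solve-∀

avoids⇒leg<arm : ∀ {a b} → 1 ≤ a → AvoidsSpContent±1 (hook a b) → b < a
avoids⇒leg<arm {suc a} {b} _ avoids = ≰⇒> λ a+1≤b →
  proj₁ (avoids (suc (suc a)) 1 (hook-leg-cell (suc a) (s≤s (s≤s z≤n)) (s≤s a+1≤b)))
    (trans (cSp-hook-leg (suc a) (s≤s (s≤s z≤n)) (s≤s a+1≤b)) (simplify (+ a)))
  where
  simplify : ∀ x → + 1 + x - (+ 2 + x) + + 2 ≡ + 1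
  simplify = solve-∀

avoids⇒arm≤leg+1 : ∀ {a b} → AvoidsSpContent±1 (hook a b) → a ≤ suc b
avoids⇒arm≤leg+1 {b = b} avoids = ≮⇒≥ λ b+2≤a →
  proj₁ (avoids 1 (suc (suc b)) (hook-arm-cell b (s≤s z≤n) b+2≤a))
    (trans (cSp-hook-arm b (s≤s (s≤s z≤n)) b+2≤a) (simplify (+ b)))
  where
  simplify : ∀ x → + 2 + x - x - + 1 ≡ + 1
  simplify = solve-∀

avoids⇒leg≤1 : ∀ {a b} → b ≤ a → AvoidsSpContent±1 (hook a b) → b ≤ 1
avoids⇒leg≤1 {b = zero}              _ _ = z≤n
avoids⇒leg≤1 {b = suc zero}          _ _ = s≤s z≤n
avoids⇒leg≤1 {b = b@(suc (suc _))} b≤a avoids = ⊥-elim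
  (proj₂ (avoids 1 b (hook-arm-cell b (s≤s z≤n) b≤a))
    (trans (cSp-hook-arm b (s≤s (s≤s z≤n)) b≤a) (simplify (+ b))))
  where
  simplify : ∀ x → x - x - + 1 ≡ - (+ 1)
  simplify = solve-∀

avoids-hook-1-0 : AvoidsSpContent±1 (hook 1 0)
avoids-hook-1-0 1 1 _ = (λ ()) , (λ ())
avoids-hook-1-0 1 (suc (suc _)) (_ , _ , s≤s ())
avoids-hook-1-0 (suc (suc _)) _ (_ , s≤s _ , ())

avoids-hook-2-1 : AvoidsSpContent±1 (hook 2 1)
avoids-hook-2-1 1 1 _ = (λ ()) , (λ ())
avoids-hook-2-1 1 2 _ = (λ ()) , (λ ())
avoids-hook-2-1 1 (suc (suc (suc _))) (_ , _ , s≤s (s≤s ()))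
avoids-hook-2-1 2 1 _ = (λ ()) , (λ ())
avoids-hook-2-1 2 (suc (suc _)) (_ , _ , s≤s ())
avoids-hook-2-1 (suc (suc (suc _))) _ (_ , s≤s _ , ())

corollary2p6 : (a b : ℕ) → 1 ≤ a →
    ((∀ i j → InDiagram (hook a b) i j →
        ¬ (cSp (hook a b) i j ≡ + 1) × ¬ (cSp (hook a b) i j ≡ - (+ 1)))
     ⇔ ((a ≡ 1 × b ≡ 0) ⊎ (a ≡ 2 × b ≡ 1)))
corollary2p6 a b a≥1 = mk⇔ avoids⇒small-hook small-hook⇒avoids
  where
  classify : ∀ {a b} → suc b ≡ a → b ≤ 1 → (a ≡ 1 × b ≡ 0) ⊎ (a ≡ 2 × b ≡ 1)
  classify refl z≤n       = inj₁ (refl , refl)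
  classify refl (s≤s z≤n) = inj₂ (refl , refl)

  avoids⇒small-hook : AvoidsSpContent±1 (hook a b) → (a ≡ 1 × b ≡ 0) ⊎ (a ≡ 2 × b ≡ 1)
  avoids⇒small-hook avoids = classify (≤-antisym b<a (avoids⇒arm≤leg+1 avoids))
                                      (avoids⇒leg≤1 (<⇒≤ b<a) avoids)
    where
    b<a : b < a
    b<a = avoids⇒leg<arm a≥1 avoids

  small-hook⇒avoids : (a ≡ 1 × b ≡ 0) ⊎ (a ≡ 2 × b ≡ 1) → AvoidsSpContent±1 (hook a b)
  small-hook⇒avoids (inj₁ (refl , refl)) = avoids-hook-1-0
  small-hook⇒avoids (inj₂ (refl , refl)) = avoids-hook-2-1
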